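{- Let $\theta\in(0,1]$ and let $(b_n)_{n=1}^\infty$ be a weak greedy approximation of $\theta$. Let $(a_n)_{n=1}^\infty$ be defined by $a_n=G\left(\theta-\sum_{i=1}^{n-1}\frac{1}{b_i}\right)$ for all $n\geqslant1$. The following are equivalent: (i) for every real $t\geqslant 1$, the set $\{n: b_n/a_n\leqslant t\}$ is finite; (ii) $\lim_{n\to\infty} a_{n+1}/a_n=1$.
   Context: For $x\in(0,1]$, $G(x)=\lfloor 1/x\rfloor+1$, i.e. the unique integer $a\geqslant 2$ with $\frac1a<x\leqslant\frac{1}{a-1}$. A sequence of positive integers $(b_n)_{n=1}^\infty$ is a weak greedy approximation of $\theta\in(0,1]$ if $\sum_{n=1}^\infty 1/b_n=\theta$ and $G\left(\theta-\sum_{i=1}^{n-1}\frac1{b_i}\right)\leqslant b_n$ for all $n\geqslant1$ (empty sum for $n=1$). -}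

module Defs where

open import Data.Nat as ℕ using (ℕ; zero; suc)
open import Data.Integer using (+_)
open import Data.Rational using (ℚ; _/_; _+_; _-_; _*_; _<_; _≤_; ∣_∣; 0ℚ; 1ℚ)
open import Data.Product using (∃-syntax; _×_)

-- Sequences are 0-indexed: b 0 = b_1, b 1 = b_2, ...

-- m / d as a rational, with the convention m / 0 = 0 (only used for d ≥ 1).
frac : ℕ → ℕ → ℚ
frac m zero    = 0ℚ
frac m (suc d) = (+ m) / suc d

toℚ : ℕ → ℚ
toℚ n = (+ n) / 1

T : (ℕ → ℕ) → ℕ → ℕ → ℚ
T b n zero    = 0ℚ
T b n (suc k) = frac 1 (b n) + T b (suc n) k

-- Remainder r_n = θ - Σ_{i<n} 1/b_i = Σ_{i≥n} 1/b_i = sup_k T b n k.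
-- IsG b n a  ⟺  a = G(r_n), i.e. a ≥ 2 and 1/a < r_n ≤ 1/(a-1).
--   1/a < r_n        ⟺ some finite tail partial sum exceeds 1/a
--   r_n ≤ 1/(a-1)    ⟺ every finite tail partial sum is ≤ 1/(a-1)
IsG : (ℕ → ℕ) → ℕ → ℕ → Set
IsG b n a = (2 ℕ.≤ a)
          × (∃[ k ] (frac 1 a < T b n k))
          × (∀ k → T b n k ≤ frac 1 (a ℕ.∸ 1))

-- (b_n) is a weak greedy approximation of θ := Σ 1/b_n with θ ∈ (0,1]:
--   b_n ≥ 1, the series has all partial sums ≤ 1 (so it converges to some θ ≤ 1;
--   θ > 0 is automatic), and G(r_n) ≤ b_n for every n.
WeakGreedy : (ℕ → ℕ) → Set
WeakGreedy b = (∀ n → 1 ℕ.≤ b n)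
             × (∀ k → T b 0 k ≤ 1ℚ)
             × (∀ n a → IsG b n a → a ℕ.≤ b n)

CondI : (ℕ → ℕ) → (ℕ → ℕ) → Set
CondI a b = ∀ (t : ℚ) → 1ℚ ≤ t → ∃[ N ] (∀ n → N ℕ.≤ n → t < frac (b n) (a n))

CondII : (ℕ → ℕ) → Set
CondII a = ∀ (ε : ℚ) → 0ℚ < ε → ∃[ N ] (∀ n → N ℕ.≤ n → ∣ frac (a (suc n)) (a n) - 1ℚ ∣ < ε)

{-# OPTIONS --safe #-}
-- Write r_n for the remainder θ - Σ_{i<n} 1/b_i, so that r_n = 1/b_n + r_{n+1} and
-- 1/a_n < r_n ≤ 1/(a_n - 1).  Hence
--   1/a_n - 1/(a_{n+1} - 1) < 1/b_n < 1/(a_n - 1) - 1/a_{n+1}.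
-- The right inequality makes (a_n) nondecreasing.  It is also unbounded: while a_p < M,
-- some tail sum starting at p exceeds 1/M, and chaining M + 1 of them would push a
-- partial sum of Σ 1/b_n above 1.  With e = a_{n+1} - a_n both bounds say b_n ≈ a_n² / (e ± 1), so
-- b_n / a_n → ∞ exactly when e / a_n → 0 (the ± 1 being absorbed since a_n → ∞).
module Submission where

open import Defs
open import Data.Nat using (ℕ; zero; suc; _+_; _*_; _∸_; _⊔_; _≤_; _<_; _≤?_; _<?_; z≤n; s≤s)
open import Data.Nat.Properties
open import Data.Nat.Tactic.RingSolver using (solve)
open import Data.List using (_∷_; [])
import Data.Integer as ℤ
import Data.Integer.Properties as ℤ
open import Data.Rational as ℚ using (mkℚ; 0ℚ; 1ℚ; toℚᵘ)
import Data.Rational.Properties as ℚ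
open import Data.Rational.Unnormalised as ℚᵘ using (mkℚᵘ)
import Data.Rational.Unnormalised.Properties as ℚᵘ
open import Function.Bundles using (_⇔_; mk⇔)
open import Data.Product using (_,_; _×_; ∃-syntax; proj₁; proj₂)
open import Data.Sum using (_⊎_; inj₁; inj₂)
open import Data.Empty using (⊥-elim)
open import Relation.Nullary using (yes; no)
open import Relation.Binary.PropositionalEquality

toℚᵘ-frac : ∀ m d → toℚᵘ (frac m (suc d)) ℚᵘ.≃ mkℚᵘ (ℤ.+ m) d
toℚᵘ-frac m d = ℚ.toℚᵘ-fromℚᵘ (mkℚᵘ (ℤ.+ m) d)

frac-≤⇒*-≤ : ∀ m n D E → 1 ≤ D → 1 ≤ E → frac m D ℚ.≤ frac n E → m * E ≤ n * D
frac-≤⇒*-≤ m n (suc d) (suc e) _ _ le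
  with ℚᵘ.≤-respʳ-≃ (toℚᵘ-frac n e) (ℚᵘ.≤-respˡ-≃ (toℚᵘ-frac m d) (ℚ.toℚᵘ-mono-≤ le))
... | ℚᵘ.*≤* le′ rewrite sym (ℤ.pos-* m (suc e)) | sym (ℤ.pos-* n (suc d)) = ℤ.drop‿+≤+ le′

frac-<⇒*-< : ∀ m n D E → 1 ≤ D → 1 ≤ E → frac m D ℚ.< frac n E → m * E < n * D
frac-<⇒*-< m n (suc d) (suc e) _ _ lt
  with ℚᵘ.<-respʳ-≃ (toℚᵘ-frac n e) (ℚᵘ.<-respˡ-≃ (toℚᵘ-frac m d) (ℚ.toℚᵘ-mono-< lt))
... | ℚᵘ.*<* lt′ rewrite sym (ℤ.pos-* m (suc e)) | sym (ℤ.pos-* n (suc d)) = ℤ.drop‿+<+ lt′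

*-≤⇒frac-≤ : ∀ m n D E → 1 ≤ D → 1 ≤ E → m * E ≤ n * D → frac m D ℚ.≤ frac n E
*-≤⇒frac-≤ m n (suc d) (suc e) _ _ le = ℚ.toℚᵘ-cancel-≤
  (ℚᵘ.≤-respʳ-≃ (ℚᵘ.≃-sym (toℚᵘ-frac n e)) (ℚᵘ.≤-respˡ-≃ (ℚᵘ.≃-sym (toℚᵘ-frac m d))
    (ℚᵘ.*≤* (subst₂ ℤ._≤_ (ℤ.pos-* m (suc e)) (ℤ.pos-* n (suc d)) (ℤ.+≤+ le)))))

*-<⇒frac-< : ∀ m n D E → 1 ≤ D → 1 ≤ E → m * E < n * D → frac m D ℚ.< frac n E
*-<⇒frac-< m n (suc d) (suc e) _ _ lt = ℚ.toℚᵘ-cancel-<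
  (ℚᵘ.<-respʳ-≃ (ℚᵘ.≃-sym (toℚᵘ-frac n e)) (ℚᵘ.<-respˡ-≃ (ℚᵘ.≃-sym (toℚᵘ-frac m d))
    (ℚᵘ.*<* (subst₂ ℤ._<_ (ℤ.pos-* m (suc e)) (ℤ.pos-* n (suc d)) (ℤ.+<+ lt)))))

frac-+ : ∀ m n D E → 1 ≤ D → 1 ≤ E →
         frac m D ℚ.+ frac n E ≡ frac (m * E + n * D) (D * E)
frac-+ m n (suc d) (suc e) _ _ = ℚ.toℚᵘ-injective (begin
  toℚᵘ (frac m (suc d) ℚ.+ frac n (suc e))
    ≈⟨ ℚ.toℚᵘ-homo-+ (frac m (suc d)) (frac n (suc e)) ⟩
  toℚᵘ (frac m (suc d)) ℚᵘ.+ toℚᵘ (frac n (suc e))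
    ≈⟨ ℚᵘ.+-cong (toℚᵘ-frac m d) (toℚᵘ-frac n e) ⟩
  mkℚᵘ (ℤ.+ m ℤ.* ℤ.+ suc e ℤ.+ ℤ.+ n ℤ.* ℤ.+ suc d) _
    ≡⟨ cong (λ z → mkℚᵘ z _) numerator ⟩
  mkℚᵘ (ℤ.+ (m * suc e + n * suc d)) _
    ≈⟨ toℚᵘ-frac _ _ ⟨
  toℚᵘ (frac (m * suc e + n * suc d) (suc d * suc e)) ∎)
  where
  open ℚᵘ.≃-Reasoning
  numerator : ℤ.+ m ℤ.* ℤ.+ suc e ℤ.+ ℤ.+ n ℤ.* ℤ.+ suc d ≡ ℤ.+ (m * suc e + n * suc d)
  numerator = trans (cong₂ ℤ._+_ (sym (ℤ.pos-* m (suc e))) (sym (ℤ.pos-* n (suc d))))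
                    (sym (ℤ.pos-+ (m * suc e) (n * suc d)))

frac-∸-1 : ∀ {m A} → 1 ≤ A → A ≤ m → frac m A ℚ.- 1ℚ ≡ frac (m ∸ A) A
frac-∸-1 {m} {A} 1≤A A≤m = begin
  frac m A ℚ.- 1ℚ                         ≡⟨ cong (ℚ._- 1ℚ) split ⟩
  frac (m ∸ A) A ℚ.+ 1ℚ ℚ.- 1ℚ            ≡⟨ ℚ.+-assoc (frac (m ∸ A) A) 1ℚ (ℚ.- 1ℚ) ⟩
  frac (m ∸ A) A ℚ.+ (1ℚ ℚ.- 1ℚ)          ≡⟨ cong (frac (m ∸ A) A ℚ.+_) (ℚ.+-inverseʳ 1ℚ) ⟩
  frac (m ∸ A) A ℚ.+ 0ℚ                   ≡⟨ ℚ.+-identityʳ _ ⟩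
  frac (m ∸ A) A                          ∎
  where
  open ≡-Reasoning
  split : frac m A ≡ frac (m ∸ A) A ℚ.+ 1ℚ
  split = sym (trans (frac-+ (m ∸ A) 1 A 1 1≤A (s≤s z≤n))
    (cong₂ frac (trans (cong₂ _+_ (*-identityʳ (m ∸ A)) (*-identityˡ A)) (m∸n+n≡m A≤m))
                (*-identityʳ A)))

0<frac-1 : ∀ D → 1 ≤ D → 0ℚ ℚ.< frac 1 D
0<frac-1 D 1≤D = *-<⇒frac-< 0 1 1 D (s≤s z≤n) 1≤D (s≤s z≤n)

ℕ-above : ∀ t → ∃[ K ] t ℚ.≤ frac K 1
ℕ-above (mkℚ (ℤ.+ m) d _) = m , ℚ.toℚᵘ-cancel-≤ (ℚᵘ.≤-respʳ-≃ (ℚᵘ.≃-sym (toℚᵘ-frac m 0))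
  (ℚᵘ.*≤* (subst₂ ℤ._≤_ (ℤ.pos-* m 1) (ℤ.pos-* m (suc d))
    (ℤ.+≤+ (≤-trans (≤-reflexive (*-identityʳ m)) (m≤m*n m (suc d)))))))
ℕ-above (mkℚ ℤ.-[1+ m ] d _) = 0 , ℚ.toℚᵘ-cancel-≤ (ℚᵘ.≤-respʳ-≃ (ℚᵘ.≃-sym (toℚᵘ-frac 0 0)) (ℚᵘ.*≤* ℤ.-≤+))

unit-fraction-below : ∀ ε → 0ℚ ℚ.< ε → ∃[ d ] frac 1 (suc d) ℚ.≤ ε
unit-fraction-below (mkℚ (ℤ.+ zero) d _) (ℚ.*<* (ℤ.+<+ ()))
unit-fraction-below (mkℚ ℤ.+[1+ m ] d _) _ = d , ℚ.toℚᵘ-cancel-≤ (ℚᵘ.≤-respˡ-≃ (ℚᵘ.≃-sym (toℚᵘ-frac 1 d))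
  (ℚᵘ.*≤* (subst₂ ℤ._≤_ (ℤ.pos-* 1 (suc d)) (ℤ.pos-* (suc m) (suc d))
    (ℤ.+≤+ (*-monoˡ-≤ (suc d) {1} {suc m} (s≤s z≤n))))))
unit-fraction-below (mkℚ ℤ.-[1+ m ] d _) (ℚ.*<* ())

[1+j]/M≤1/A+j/M : ∀ {j A M} → 1 ≤ A → 1 ≤ M → A ≤ M → frac (suc j) M ℚ.≤ frac 1 A ℚ.+ frac j M
[1+j]/M≤1/A+j/M {j} {A} {M} 1≤A 1≤M A≤M = subst (frac (suc j) M ℚ.≤_) (sym (frac-+ 1 j A M 1≤A 1≤M))
  (*-≤⇒frac-≤ (suc j) _ M (A * M) 1≤M (*-mono-≤ 1≤A 1≤M) cross)
  where
  open ≤-Reasoning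
  cross : suc j * (A * M) ≤ (1 * M + j * A) * M
  cross = begin
    suc j * (A * M)       ≡⟨ solve (j ∷ A ∷ M ∷ []) ⟩
    A * M + j * A * M     ≤⟨ +-monoˡ-≤ (j * A * M) (*-monoˡ-≤ M A≤M) ⟩
    M * M + j * A * M     ≡⟨ solve (j ∷ A ∷ M ∷ []) ⟩
    (1 * M + j * A) * M   ∎

T-+ : ∀ b n k m → T b n (k + m) ≡ T b n k ℚ.+ T b (n + k) m
T-+ b n zero m rewrite +-identityʳ n = sym (ℚ.+-identityˡ _)
T-+ b n (suc k) m rewrite +-suc n k | T-+ b (suc n) k m =
  sym (ℚ.+-assoc (frac 1 (b n)) (T b (suc n) k) (T b (suc (n + k)) m))

upper-cross⇒A≤A′ : ∀ A A′ B → (A′ + B) * (A ∸ 1) < B * A′ → A ≤ A′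
upper-cross⇒A≤A′ A A′ B upper with A ≤? A′
... | yes A≤A′ = A≤A′
... | no A≰A′ = ⊥-elim (<-irrefl refl (<-≤-trans upper (begin
  B * A′              ≤⟨ *-monoʳ-≤ B (∸-monoˡ-≤ 1 (≰⇒> A≰A′)) ⟩
  B * (A ∸ 1)         ≤⟨ *-monoˡ-≤ (A ∸ 1) (m≤n+m B A′) ⟩
  (A′ + B) * (A ∸ 1)  ∎)))
  where open ≤-Reasoning

lower-cross⇒c*f<A : ∀ c A f B → suc c * A ≤ B → B * (A + f) < (A + f + B) * A → c * f < A
lower-cross⇒c*f<A c A f B ratio lower = +-cancelˡ-< f (c * f) A
  (subst (suc c * f <_) (+-comm A f) (*-cancelʳ-< A (suc c * f) (A + f) (begin-strict
    suc c * f * A   ≡⟨ solve (c ∷ A ∷ f ∷ []) ⟩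
    suc c * A * f   ≤⟨ *-monoˡ-≤ f ratio ⟩
    B * f           <⟨ Bf<[A+f]A ⟩
    (A + f) * A     ∎)))
  where
  open ≤-Reasoning
  Bf<[A+f]A : B * f < (A + f) * A
  Bf<[A+f]A = +-cancelˡ-< (B * A) (B * f) ((A + f) * A) (begin-strict
    B * A + B * f        ≡⟨ solve (A ∷ f ∷ B ∷ []) ⟩
    B * (A + f)          <⟨ lower ⟩
    (A + f + B) * A      ≡⟨ solve (A ∷ f ∷ B ∷ []) ⟩
    B * A + (A + f) * A  ∎)

lower-cross⇒L*e<A : ∀ L A e B → 2 * L < A → suc (2 * L) * A ≤ B →
                    B * (A + e ∸ 1) < (A + e ∸ 1 + B) * A → L * e < A
lower-cross⇒L*e<A L A zero B 2L<A _ _ rewrite *-zeroʳ L = ≤-<-trans z≤n 2L<A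
lower-cross⇒L*e<A L A (suc f) B 2L<A ratio lower rewrite +-suc A f =
  *-cancelˡ-< 2 (L * suc f) A (begin-strict
    2 * (L * suc f)     ≡⟨ solve (L ∷ f ∷ []) ⟩
    2 * L * f + 2 * L   <⟨ +-mono-< (lower-cross⇒c*f<A (2 * L) A f B ratio lower) 2L<A ⟩
    A + A               ≡⟨ solve (A ∷ []) ⟩
    2 * A               ∎)
  where open ≤-Reasoning

upper-cross⇒L*A<B : ∀ L A e B → 2 * L * e < A → 2 * L < A →
                    (A + e + B) * (A ∸ 1) < B * (A + e) → L * A < B
upper-cross⇒L*A<B L (suc D) e B gap 2L<A upper with L * suc D <? B
... | yes LA<B = LA<B
... | no LA≮B = ⊥-elim (<-irrefl refl (begin-strict
  2 * D                       <⟨ *-monoʳ-< 2 D<L[1+e] ⟩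
  2 * (L * suc e)             ≡⟨ solve (L ∷ e ∷ []) ⟩
  2 * L * e + 2 * L           ≤⟨ +-mono-≤ (≤-pred gap) (≤-pred 2L<A) ⟩
  D + D                       ≡⟨ solve (D ∷ []) ⟩
  2 * D                       ∎))
  where
  open ≤-Reasoning
  [1+D+e]D<B[1+e] : (suc D + e) * D < B * suc e
  [1+D+e]D<B[1+e] = +-cancelˡ-< (B * D) ((suc D + e) * D) (B * suc e) (begin-strict
    B * D + (suc D + e) * D  ≡⟨ solve (D ∷ e ∷ B ∷ []) ⟩
    (suc D + e + B) * D      <⟨ upper ⟩
    B * (suc D + e)          ≡⟨ solve (D ∷ e ∷ B ∷ []) ⟩
    B * D + B * suc e        ∎)
  D<L[1+e] : D < L * suc e
  D<L[1+e] = *-cancelˡ-< (suc D) D (L * suc e) (begin-strict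
    suc D * D               ≤⟨ *-monoˡ-≤ D (m≤m+n (suc D) e) ⟩
    (suc D + e) * D         <⟨ [1+D+e]D<B[1+e] ⟩
    B * suc e               ≤⟨ *-monoˡ-≤ (suc e) (≮⇒≥ LA≮B) ⟩
    L * suc D * suc e       ≡⟨ solve (L ∷ D ∷ e ∷ []) ⟩
    suc D * (L * suc e)     ∎)

Eventually : (ℕ → Set) → Set
Eventually P = ∃[ N ] (∀ n → N ≤ n → P n)

eventually-map : ∀ {P Q} → (∀ n → P n → Q n) → Eventually P → Eventually Q
eventually-map f (N , p) = N , λ n N≤n → f n (p n N≤n)

eventually-× : ∀ {P Q} → Eventually P → Eventually Q → Eventually (λ n → P n × Q n)
eventually-× (N₁ , p) (N₂ , q) =
  N₁ ⊔ N₂ , λ n N≤n → p n (m⊔n≤o⇒m≤o N₁ N₂ N≤n) , q n (m⊔n≤o⇒n≤o N₁ N₂ N≤n)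

eventually-≥-of-monotone : ∀ (f : ℕ → ℕ) → (∀ n → f n ≤ f (suc n)) →
                           ∀ {M} → ∃[ N ] M ≤ f N → Eventually (λ n → M ≤ f n)
eventually-≥-of-monotone f mono (N , M≤fN) = N , λ n N≤n → ≤-trans M≤fN (mono-≤ N≤n)
  where
  mono-≤ : ∀ {m n} → m ≤ n → f m ≤ f n
  mono-≤ {m} {n} m≤n = subst (λ k → f m ≤ f k) (m∸n+n≡m m≤n) (shift (n ∸ m))
    where
    shift : ∀ k → f m ≤ f (k + m)
    shift zero = ≤-refl
    shift (suc k) = ≤-trans (shift k) (mono (k + m))

1/A<1/B+1/C⇒BC<[C+B]A : ∀ A B C → 1 ≤ A → 1 ≤ B → 1 ≤ C →
                         frac 1 A ℚ.< frac 1 B ℚ.+ frac 1 C → B * C < (C + B) * A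
1/A<1/B+1/C⇒BC<[C+B]A A B C 1≤A 1≤B 1≤C lt
  with frac-<⇒*-< 1 _ A (B * C) 1≤A (*-mono-≤ 1≤B 1≤C) (subst (frac 1 A ℚ.<_) (frac-+ 1 1 B C 1≤B 1≤C) lt)
... | cross rewrite *-identityˡ (B * C) | *-identityˡ C | *-identityˡ B = cross

1/B+1/C<1/A⇒[C+B]A<BC : ∀ A B C → 1 ≤ A → 1 ≤ B → 1 ≤ C →
                         frac 1 B ℚ.+ frac 1 C ℚ.< frac 1 A → (C + B) * A < B * C
1/B+1/C<1/A⇒[C+B]A<BC A B C 1≤A 1≤B 1≤C lt
  with frac-<⇒*-< _ 1 (B * C) A (*-mono-≤ 1≤B 1≤C) 1≤A (subst (ℚ._< frac 1 A) (frac-+ 1 1 B C 1≤B 1≤C) lt)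
... | cross rewrite *-identityˡ (B * C) | *-identityˡ C | *-identityˡ B = cross

RatioDiverges : (ℕ → ℕ) → (ℕ → ℕ) → Set
RatioDiverges a b = ∀ L → Eventually (λ n → L * a n < b n)

GapsNegligible : (ℕ → ℕ) → Set
GapsNegligible a = ∀ L → Eventually (λ n → L * (a (suc n) ∸ a n) < a n)

module _ (a b : ℕ → ℕ) (a≥1 : ∀ n → 1 ≤ a n) where

  CondI⇒RatioDiverges : CondI a b → RatioDiverges a b
  CondI⇒RatioDiverges condI L =
    eventually-map ratio (condI (frac (suc L) 1) (*-≤⇒frac-≤ 1 (suc L) 1 1 (s≤s z≤n) (s≤s z≤n) (s≤s z≤n)))
    where
    ratio : ∀ n → frac (suc L) 1 ℚ.< frac (b n) (a n) → L * a n < b n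
    ratio n lt = ≤-<-trans (*-monoˡ-≤ (a n) (n≤1+n L))
      (subst (suc L * a n <_) (*-identityʳ (b n)) (frac-<⇒*-< (suc L) (b n) 1 (a n) (s≤s z≤n) (a≥1 n) lt))

  RatioDiverges⇒CondI : RatioDiverges a b → CondI a b
  RatioDiverges⇒CondI diverges t _ with ℕ-above t
  ... | K , t≤K = eventually-map ratio (diverges K)
    where
    ratio : ∀ n → K * a n < b n → t ℚ.< frac (b n) (a n)
    ratio n lt = ℚ.≤-<-trans t≤K
      (*-<⇒frac-< K (b n) 1 (a n) (s≤s z≤n) (a≥1 n) (subst (K * a n <_) (sym (*-identityʳ (b n))) lt))

module _ (a : ℕ → ℕ) (a≥1 : ∀ n → 1 ≤ a n) (a-mono : ∀ n → a n ≤ a (suc n)) where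

  ∣ratio-1∣≡gap/a : ∀ n → ℚ.∣ frac (a (suc n)) (a n) ℚ.- 1ℚ ∣ ≡ frac (a (suc n) ∸ a n) (a n)
  ∣ratio-1∣≡gap/a n rewrite frac-∸-1 (a≥1 n) (a-mono n) =
    ℚ.0≤p⇒∣p∣≡p (*-≤⇒frac-≤ 0 _ 1 (a n) (s≤s z≤n) (a≥1 n) z≤n)

  CondII⇒GapsNegligible : CondII a → GapsNegligible a
  CondII⇒GapsNegligible condII L = eventually-map gap-small (condII (frac 1 (suc L)) (0<frac-1 (suc L) (s≤s z≤n)))
    where
    gap-small : ∀ n → ℚ.∣ frac (a (suc n)) (a n) ℚ.- 1ℚ ∣ ℚ.< frac 1 (suc L) → L * (a (suc n) ∸ a n) < a n
    gap-small n lt = ≤-<-trans (*-monoˡ-≤ (a (suc n) ∸ a n) (n≤1+n L))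
      (subst₂ _<_ (*-comm (a (suc n) ∸ a n) (suc L)) (*-identityˡ (a n))
        (frac-<⇒*-< _ 1 (a n) (suc L) (a≥1 n) (s≤s z≤n) (subst (ℚ._< frac 1 (suc L)) (∣ratio-1∣≡gap/a n) lt)))

  GapsNegligible⇒CondII : GapsNegligible a → CondII a
  GapsNegligible⇒CondII negligible ε 0<ε with unit-fraction-below ε 0<ε
  ... | d , 1/[1+d]≤ε = eventually-map close (negligible (suc d))
    where
    close : ∀ n → suc d * (a (suc n) ∸ a n) < a n → ℚ.∣ frac (a (suc n)) (a n) ℚ.- 1ℚ ∣ ℚ.< ε
    close n lt = subst (ℚ._< ε) (sym (∣ratio-1∣≡gap/a n)) (ℚ.<-≤-trans
      (*-<⇒frac-< _ 1 (a n) (suc d) (a≥1 n) (s≤s z≤n)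
        (subst₂ _<_ (*-comm (suc d) (a (suc n) ∸ a n)) (sym (*-identityˡ (a n))) lt))
      1/[1+d]≤ε)

module GreedyDenominators (b : ℕ → ℕ) (wg : WeakGreedy b) (a : ℕ → ℕ) (isG : ∀ n → IsG b n (a n)) where

  b≥1 : ∀ n → 1 ≤ b n
  b≥1 = proj₁ wg

  a≥1 : ∀ n → 1 ≤ a n
  a≥1 n = ≤-trans (s≤s z≤n) (proj₁ (isG n))

  a∸1≥1 : ∀ n → 1 ≤ a n ∸ 1
  a∸1≥1 n = ∸-monoˡ-≤ 1 (proj₁ (isG n))

  lower-cross : ∀ n → b n * (a (suc n) ∸ 1) < (a (suc n) ∸ 1 + b n) * a n
  lower-cross n = 1/A<1/B+1/C⇒BC<[C+B]A _ _ _ (a≥1 n) (b≥1 n) (a∸1≥1 (suc n)) (remainder-split (isG n) (isG (suc n)))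
    where
    remainder-split : IsG b n (a n) → IsG b (suc n) (a (suc n)) →
                      frac 1 (a n) ℚ.< frac 1 (b n) ℚ.+ frac 1 (a (suc n) ∸ 1)
    remainder-split (_ , (zero , lt) , _) _ = ⊥-elim (ℚ.<-asym lt (0<frac-1 (a n) (a≥1 n)))
    remainder-split (_ , (suc k , lt) , _) (_ , _ , upper) = ℚ.<-≤-trans lt (ℚ.+-monoʳ-≤ (frac 1 (b n)) (upper k))

  upper-cross : ∀ n → (a (suc n) + b n) * (a n ∸ 1) < b n * a (suc n)
  upper-cross n = 1/B+1/C<1/A⇒[C+B]A<BC _ _ _ (a∸1≥1 n) (b≥1 n) (a≥1 (suc n)) (remainder-split (isG n) (isG (suc n)))
    where
    remainder-split : IsG b n (a n) → IsG b (suc n) (a (suc n)) →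
                      frac 1 (b n) ℚ.+ frac 1 (a (suc n)) ℚ.< frac 1 (a n ∸ 1)
    remainder-split (_ , _ , upper) (_ , (k , lt) , _) = ℚ.<-≤-trans (ℚ.+-monoʳ-< (frac 1 (b n)) lt) (upper (suc k))

  a-mono : ∀ n → a n ≤ a (suc n)
  a-mono n = upper-cross⇒A≤A′ (a n) (a (suc n)) (b n) (upper-cross n)

  -- A disjunction rather than a contradiction, so that unboundedness yields an index.
  large-or-tail-≥ : ∀ M → 1 ≤ M → ∀ j p → (∃[ N ] M ≤ a N) ⊎ (∃[ q ] frac j M ℚ.≤ T b p q)
  large-or-tail-≥ M 1≤M zero p = inj₂ (0 , *-≤⇒frac-≤ 0 0 M 1 1≤M (s≤s z≤n) z≤n)
  large-or-tail-≥ M 1≤M (suc j) p with M ≤? a p | proj₁ (proj₂ (isG p))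
  ... | yes M≤a | _ = inj₁ (p , M≤a)
  ... | no M≰a | k , 1/a<T with large-or-tail-≥ M 1≤M j (p + k)
  ...   | inj₁ large = inj₁ large
  ...   | inj₂ (q , j/M≤T) = inj₂ (k + q , subst (frac (suc j) M ℚ.≤_) (sym (T-+ b p k q))
          (ℚ.≤-trans ([1+j]/M≤1/A+j/M (a≥1 p) 1≤M (<⇒≤ (≰⇒> M≰a))) (ℚ.+-mono-≤ (ℚ.<⇒≤ 1/a<T) j/M≤T)))

  a-unbounded : ∀ M → ∃[ N ] M ≤ a N
  a-unbounded M with large-or-tail-≥ (suc M) (s≤s z≤n) (suc (suc M)) 0
  ... | inj₁ (N , 1+M≤a) = N , ≤-trans (n≤1+n M) 1+M≤a
  ... | inj₂ (q , [2+M]/[1+M]≤T) = ⊥-elim (<-irrefl refl (subst₂ _<_ (*-identityʳ (suc M)) (*-identityˡ (suc M))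
          (frac-≤⇒*-≤ (suc (suc M)) 1 (suc M) 1 (s≤s z≤n) (s≤s z≤n) (ℚ.≤-trans [2+M]/[1+M]≤T (proj₁ (proj₂ wg) q)))))

  a-eventually-≥ : ∀ M → Eventually (λ n → M ≤ a n)
  a-eventually-≥ M = eventually-≥-of-monotone a a-mono (a-unbounded M)

  RatioDiverges⇒GapsNegligible : RatioDiverges a b → GapsNegligible a
  RatioDiverges⇒GapsNegligible diverges L =
    eventually-map gap-small (eventually-× (diverges (suc (2 * L))) (a-eventually-≥ (suc (2 * L))))
    where
    gap-small : ∀ n → suc (2 * L) * a n < b n × 2 * L < a n → L * (a (suc n) ∸ a n) < a n
    gap-small n (ratio , 2L<a) = lower-cross⇒L*e<A L (a n) (a (suc n) ∸ a n) (b n) 2L<a (<⇒≤ ratio)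
      (subst (λ a′ → b n * (a′ ∸ 1) < (a′ ∸ 1 + b n) * a n) (sym (m+[n∸m]≡n (a-mono n))) (lower-cross n))

  GapsNegligible⇒RatioDiverges : GapsNegligible a → RatioDiverges a b
  GapsNegligible⇒RatioDiverges negligible L =
    eventually-map ratio-large (eventually-× (negligible (2 * L)) (a-eventually-≥ (suc (2 * L))))
    where
    ratio-large : ∀ n → 2 * L * (a (suc n) ∸ a n) < a n × 2 * L < a n → L * a n < b n
    ratio-large n (gap , 2L<a) = upper-cross⇒L*A<B L (a n) (a (suc n) ∸ a n) (b n) gap 2L<a
      (subst (λ a′ → (a′ + b n) * (a n ∸ 1) < b n * a′) (sym (m+[n∸m]≡n (a-mono n))) (upper-cross n))

proposition3 : (b : ℕ → ℕ) → WeakGreedy b →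
               (a : ℕ → ℕ) → (∀ n → IsG b n (a n)) →
               CondI a b ⇔ CondII a
proposition3 b wg a isG = mk⇔
  (λ condI → GapsNegligible⇒CondII a a≥1 a-mono (RatioDiverges⇒GapsNegligible (CondI⇒RatioDiverges a b a≥1 condI)))
  (λ condII → RatioDiverges⇒CondI a b a≥1 (GapsNegligible⇒RatioDiverges (CondII⇒GapsNegligible a a≥1 a-mono condII)))
  where open GreedyDenominators b wg a isG
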